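{- Let $L=\mathrm{Log}(\{(\mathfrak F,0)\})$ for a single finite frame $\mathfrak F$ rooted at $0$. Let $\varphi$ be a modal formula and $\sigma\subseteq\mathrm{sig}(\varphi)$. If $\xi\in\mathrm{PL}(\sigma_{\mathfrak F})$ is a propositional uniform $\sigma_{\mathfrak F}$-interpolant for $\mathit{tr}_{\mathfrak F,0}(\varphi)$, then $\mathit{rt}_{\mathfrak F,L}(\xi)$ is a strongest $L(\sigma)$-implicate of $\varphi$.
   Context: For $\mathfrak F=(W,R)$ and a signature $\sigma'$, $\sigma'_{\mathfrak F}=\{p_w:p\in\sigma',w\in W\}$. $\mathit{tr}_{\mathfrak F,w}$ maps modal formulas to propositional formulas over these atoms: $p\mapsto p_w$, commuting with $\top,\neg,\wedge$, and $\Diamond\varphi\mapsto\bigvee_{(w,w')\in R}\mathit{tr}_{\mathfrak F,w'}(\varphi)$ ($\Box=\neg\Diamond\neg$). $\mathit{rt}_{\mathfrak F,L}$ (relative to $\sigma$) is defined as follows. Let $N=|W|$, $\Box^{\le N}\psi=\psi\wedge\Box\psi\wedge\dots\wedge\Box^N\psi$, $\Diamond^{\le N}=\neg\Box^{\le N}\neg$. A $\sigma$-EME is a finite set $\Phi$ of propositional formulas over $\sigma$, pairwise inconsistent, with tautological disjunction; it is a $\sigma$-cover of a model if worlds satisfying the same member agree on all atoms of $\sigma$. $\mathit{cover}(\sigma,\Phi)=\bigwedge_{\phi\in\Phi}\bigwedge_{p\in\sigma}(\Diamond^{\le N}(\phi\wedge p)\to\Box^{\le N}(\phi\to p))$. An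 abstract $\Phi$-model for $L$ is $(\mathfrak F,f)$, $f:W\to\Phi$; modal formulas over $\Phi$ treat members of $\Phi$ as atoms ($w\models\phi$ iff $f(w)=\phi$). Abstract $\Phi$-bisimulations: Forth, Back and equal $f$-values on related worlds. An abstract class identifier is a formula $\delta$ over $\Phi$ such that the abstract $\Phi$-models for $L$ satisfying $\delta$ at $0$ form exactly one abstract-$\Phi$-bisimilarity class at the root, denoted $[\delta]_L$. A $\sigma$-encoding for $L$ is $(\Gamma,\{\Delta_\Phi\}_{\Phi\in\Gamma})$, $\Gamma$ a set of $\sigma$-EMEs, $\Delta_\Phi$ sets of abstract class identifiers, such that every model $\mathfrak M$ on $\mathfrak F$ has some $\Phi\in\Gamma$ that is a $\sigma$-cover of $\mathfrak M$ and some $\delta\in\Delta_\Phi$ with $\mathfrak M,0\models\delta$. With a fixed $\sigma$-encoding, $\mathit{rt}_{\mathfrak F,L}(\xi)=\bigwedge_{\Phi\in\Gamma}\bigwedge_{\delta\in\Delta_\Phi}((\mathit{cover}(\sigma,\Phi)\wedge\delta)\to\bigvee_{(\mathfrak F,f)\in[\delta]_L}\xi^f)$, with $\xi^f$ obtained by replacing each $p_w$ by $\Diamond^{\le N}(f(w)\wedge p)$. A propositional uniform $S$-interpolant of $\xi'$: propositional $\chi$ over $S$, $\xi'\to\chi$ tautology, and $\chi\to\psi$ tautology whenever $\mathrm{sig}(\psi)\cap\mathrm{sig}(\xi')\subseteq S$ and $\xi'\to\psi$ tautology. A strongest $L(\sigma)$-implicate of $\varphi$: modal $\chi$ with $\mathrm{sig}(\chi)\subseteq\sigma$,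 $\varphi\to\chi\in L$, and $\chi\to\psi\in L$ for all $\psi$ with $\mathrm{sig}(\psi)\subseteq\sigma$ and $\varphi\to\psi\in L$. $\mathrm{Log}(\{(\mathfrak F,0)\})$: formulas true at $0$ in all models on $\mathfrak F$. -}

module Defs where

open import Data.Nat using (ℕ; zero; suc)
open import Data.Fin using (Fin; zero; suc; _≟_)
open import Data.List using (List; []; _∷_; map; concatMap; filter; foldr; _++_)
open import Data.List.Membership.Propositional using (_∈_)
open import Data.Product using (Σ; ∃; _×_; _,_; proj₁; proj₂)
open import Data.Bool using (Bool; true; false; _∧_; _∨_; not; if_then_else_)
open import Relation.Nullary using (¬_; Dec; yes; no; does)
open import Relation.Binary.PropositionalEquality using (_≡_)


allFin : (n : ℕ) → List (Fin n)
allFin zero    = []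
allFin (suc n) = zero ∷ map suc (allFin n)

consF : {m k : ℕ} → Fin k → (Fin m → Fin k) → Fin (suc m) → Fin k
consF i f zero    = i
consF i f (suc w) = f w

allFuns : (m k : ℕ) → List (Fin m → Fin k)
allFuns zero    k = (λ ()) ∷ []
allFuns (suc m) k = concatMap (λ f → map (λ i → consF i f) (allFin k)) (allFuns m k)

anyL : {A : Set} → (A → Bool) → List A → Bool
anyL p []       = false
anyL p (x ∷ xs) = p x ∨ anyL p xs

data PL (A : Set) : Set where
  atom : A → PL A
  ⊤p   : PL A
  ¬p_  : PL A → PL A
  _∧p_ : PL A → PL A → PL A

⊥p : {A : Set} → PL A
⊥p = ¬p ⊤p

_∨p_ _→p_ : {A : Set} → PL A → PL A → PL A
a ∨p b = ¬p ((¬p a) ∧p (¬p b))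
a →p b = ¬p (a ∧p (¬p b))

evalPL : {A : Set} → (A → Bool) → PL A → Bool
evalPL ν (atom a)  = ν a
evalPL ν ⊤p        = true
evalPL ν (¬p a)    = not (evalPL ν a)
evalPL ν (a ∧p b)  = evalPL ν a ∧ evalPL ν b

Taut : {A : Set} → PL A → Set
Taut {A} χ = (ν : A → Bool) → evalPL ν χ ≡ true

sigPL : {A : Set} → PL A → List A
sigPL (atom a) = a ∷ []
sigPL ⊤p       = []
sigPL (¬p a)   = sigPL a
sigPL (a ∧p b) = sigPL a ++ sigPL b

data MF (A : Set) : Set where
  var : A → MF A
  ⊤m  : MF A
  ¬m_ : MF A → MF A
  _∧m_ : MF A → MF A → MF A
  ◇_  : MF A → MF A

Fm : Set
Fm = MF ℕ

⊥m : {A : Set} → MF A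
⊥m = ¬m ⊤m

_∨m_ _→m_ : {A : Set} → MF A → MF A → MF A
a ∨m b = ¬m ((¬m a) ∧m (¬m b))
a →m b = ¬m (a ∧m (¬m b))

□_ : {A : Set} → MF A → MF A
□ a = ¬m (◇ (¬m a))

⋀m ⋁m : {A : Set} → List (MF A) → MF A
⋀m = foldr _∧m_ ⊤m
⋁m = foldr _∨m_ ⊥m

sig : {A : Set} → MF A → List A
sig (var a)  = a ∷ []
sig ⊤m       = []
sig (¬m a)   = sig a
sig (a ∧m b) = sig a ++ sig b
sig (◇ a)    = sig a

embed : {A : Set} → PL A → MF A
embed (atom a) = var a
embed ⊤p       = ⊤m
embed (¬p a)   = ¬m embed a
embed (a ∧p b) = embed a ∧m embed b

substMF : {A B : Set} → (A → MF B) → MF A → MF B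
substMF s (var a)  = s a
substMF s ⊤m       = ⊤m
substMF s (¬m a)   = ¬m substMF s a
substMF s (a ∧m b) = substMF s a ∧m substMF s b
substMF s (◇ a)    = ◇ substMF s a

□^ : {A : Set} → ℕ → MF A → MF A
□^ zero    ψ = ψ
□^ (suc i) ψ = □ (□^ i ψ)

□≤ : {A : Set} → ℕ → MF A → MF A
□≤ zero    ψ = ψ
□≤ (suc N) ψ = □≤ N ψ ∧m □^ (suc N) ψ

◇≤ : {A : Set} → ℕ → MF A → MF A
◇≤ N ψ = ¬m □≤ N (¬m ψ)

-- Finite frames with worlds Fin m (root 0 = zero when m = suc n)

Rel : ℕ → Set
Rel m = Fin m → Fin m → Bool

data Reach {m : ℕ} (R : Rel m) : Fin m → Fin m → Set where
  here  : ∀ {w} → Reach R w w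
  step  : ∀ {u v w} → R u v ≡ true → Reach R v w → Reach R u w

Rooted : {n : ℕ} → Rel (suc n) → Set
Rooted {n} R = (w : Fin (suc n)) → Reach R zero w

eval : {A : Set} {m : ℕ} → Rel m → (A → Fin m → Bool) → MF A → Fin m → Bool
eval R V (var a)  w = V a w
eval R V ⊤m       w = true
eval R V (¬m a)   w = not (eval R V a w)
eval R V (a ∧m b) w = eval R V a w ∧ eval R V b w
eval {m = m} R V (◇ a) w = anyL (λ w' → R w w' ∧ eval R V a w') (allFin m)

InLog : {n : ℕ} → Rel (suc n) → Fm → Set
InLog R ψ = (V : ℕ → Fin _ → Bool) → eval R V ψ zero ≡ true

_⊆_ : {A : Set} → List A → List A → Set
xs ⊆ ys = ∀ {a} → a ∈ xs → a ∈ ys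

-- atoms of σ_F : pairs (p , w) with p ∈ σ
InSigF : {m : ℕ} → List ℕ → ℕ × Fin m → Set
InSigF σ a = proj₁ a ∈ σ

tr : {m : ℕ} → Rel m → Fin m → Fm → PL (ℕ × Fin m)
tr R w (var p)  = atom (p , w)
tr R w ⊤m       = ⊤p
tr R w (¬m a)   = ¬p tr R w a
tr R w (a ∧m b) = tr R w a ∧p tr R w b
tr {m} R w (◇ a) =
  foldr (λ w' acc → if R w w' then (tr R w' a ∨p acc) else acc) ⊥p (allFin m)

record IsEME (σ : List ℕ) (k : ℕ) (Φ : Fin k → PL ℕ) : Set where
  field
    overσ    : ∀ i → sigPL (Φ i) ⊆ σ
    pairwise : ∀ i j → ¬ (i ≡ j) → Taut (¬p (Φ i ∧p Φ j))
    exhaust  : Taut (foldr (λ i acc → Φ i ∨p acc) ⊥p (allFin k))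

IsCover : {m : ℕ} → List ℕ → {k : ℕ} → (Fin k → PL ℕ) → (ℕ → Fin m → Bool) → Set
IsCover σ Φ V =
  ∀ i w w' → evalPL (λ p → V p w) (Φ i) ≡ true → evalPL (λ p → V p w') (Φ i) ≡ true →
  ∀ p → p ∈ σ → V p w ≡ V p w'

-- abstract Φ-model on F: f : Fin m → Fin k ; members of Φ are atoms
evalAbs : {m k : ℕ} → Rel m → (Fin m → Fin k) → MF (Fin k) → Fin m → Bool
evalAbs R f δ w = eval R (λ i w' → does (f w' ≟ i)) δ w

AbsBisim : {n k : ℕ} → Rel (suc n) → (Fin (suc n) → Fin k) → (Fin (suc n) → Fin k) → Set₁
AbsBisim {n} R f g =
  Σ (Fin (suc n) → Fin (suc n) → Set) λ Z →
    Z zero zero ×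
    (∀ w w' → Z w w' → f w ≡ g w') ×
    (∀ w w' v → Z w w' → R w v ≡ true → Σ (Fin (suc n)) λ v' → R w' v' ≡ true × Z v v') ×
    (∀ w w' v' → Z w w' → R w' v' ≡ true → Σ (Fin (suc n)) λ v → R w v ≡ true × Z v v')

record IsACI {n : ℕ} (R : Rel (suc n)) (k : ℕ) (δ : MF (Fin k)) : Set₁ where
  field
    nonempty : Σ (Fin (suc n) → Fin k) λ f → evalAbs R f δ zero ≡ true
    allBisim : ∀ f g → evalAbs R f δ zero ≡ true → evalAbs R g δ zero ≡ true → AbsBisim R f g
    closed   : ∀ f g → evalAbs R f δ zero ≡ true → AbsBisim R f g → evalAbs R g δ zero ≡ true

classOf : {n k : ℕ} → Rel (suc n) → MF (Fin k) → List (Fin (suc n) → Fin k)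
classOf {n} {k} R δ = filter (λ f → evalAbs R f δ zero Data.Bool.≟ true) (allFuns (suc n) k)

concrete : {k : ℕ} → (Fin k → PL ℕ) → MF (Fin k) → Fm
concrete Φ = substMF (λ i → embed (Φ i))

record EncEntry {n : ℕ} (R : Rel (suc n)) (σ : List ℕ) : Set₁ where
  field
    k   : ℕ
    Φ   : Fin k → PL ℕ
    eme : IsEME σ k Φ
    Δ   : List (MF (Fin k))
    aci : ∀ {δ} → δ ∈ Δ → IsACI R k δ

record Encoding {n : ℕ} (R : Rel (suc n)) (σ : List ℕ) : Set₁ where
  field
    Γ     : List (EncEntry R σ)
    total : (V : ℕ → Fin (suc n) → Bool) →
            Σ (EncEntry R σ) λ e → e ∈ Γ × IsCover σ (EncEntry.Φ e) V ×
              Σ (MF (Fin (EncEntry.k e))) λ δ → δ ∈ EncEntry.Δ e ×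
                eval R V (concrete (EncEntry.Φ e) δ) zero ≡ true

coverF : (N : ℕ) → List ℕ → {k : ℕ} → (Fin k → PL ℕ) → Fm
coverF N σ {k} Φ =
  ⋀m (map (λ i → ⋀m (map (λ p →
         ◇≤ N (embed (Φ i) ∧m var p) →m □≤ N (embed (Φ i) →m var p)) σ)) (allFin k))

instF : {n k : ℕ} → (Fin k → PL ℕ) → (Fin (suc n) → Fin k) → PL (ℕ × Fin (suc n)) → Fm
instF {n} Φ f ξ = substMF (λ a → ◇≤ (suc n) (embed (Φ (f (proj₂ a))) ∧m var (proj₁ a))) (embed ξ)

rt : {n : ℕ} (R : Rel (suc n)) (σ : List ℕ) → Encoding R σ → PL (ℕ × Fin (suc n)) → Fm
rt {n} R σ E ξ =
  ⋀m (map (λ e → let open EncEntry e in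
       ⋀m (map (λ δ → (coverF (suc n) σ Φ ∧m concrete Φ δ) →m
                        ⋁m (map (λ f → instF Φ f ξ) (classOf R δ))) Δ))
     (Encoding.Γ E))

IsUniformInterpolant : {A : Set} → (A → Set) → PL A → PL A → Set
IsUniformInterpolant {A} S ξ' χ =
  (∀ {a} → a ∈ sigPL χ → S a) ×
  Taut (ξ' →p χ) ×
  ((ψ : PL A) → (∀ a → a ∈ sigPL ψ → a ∈ sigPL ξ' → S a) → Taut (ξ' →p ψ) → Taut (χ →p ψ))

IsStrongestImplicate : {n : ℕ} → Rel (suc n) → List ℕ → Fm → Fm → Set
IsStrongestImplicate R σ φ χ =
  sig χ ⊆ σ ×
  InLog R (φ →m χ) ×
  ((ψ : Fm) → sig ψ ⊆ σ → InLog R (φ →m ψ) → InLog R (χ →m ψ))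

{-# OPTIONS --safe #-}
-- In a rooted frame with n+1 worlds every world is reachable from the root in at most n
-- steps, so at the root ◇≤(n+1) and □≤(n+1) act as universal modalities.  Consequently
-- cover(σ,Φ) holds at the root exactly when Φ is a σ-cover, and in a covered model the
-- formula ◇≤(n+1)(Φ i ∧ p) substituted for p_w in ξ^f reads off the value of p at any
-- world w of type i = f w.
-- If φ holds at the root, the valuation read as a propositional one satisfies tr(φ), hence
-- ξ, and the abstract model induced by Φ lies in [δ]; so every clause of rt(ξ) holds.
-- Conversely, if rt(ξ) holds, some f ∈ [δ] makes ξ^f true.  The propositional valuation
-- p_w ↦ ◇≤(n+1)(Φ(f w) ∧ p) then satisfies ξ, hence tr(ψ) for every σ-consequence ψ of φ
-- by uniform interpolation, and the model it defines is σ-bisimilar to the given one via the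
-- abstract bisimulation between f and the induced abstract model; so ψ holds at the root.

module Submission where

open import Defs
open import Data.Nat using (ℕ; suc)
open import Data.Product using (_×_)
open import Data.List using (List)
open import Data.Fin using (Fin; zero)

open import Data.Bool using (Bool; true; false; _∧_; _∨_; not; if_then_else_)
import Data.Bool as Bool
open import Data.Bool.Properties using (not-¬; ¬-not; not-involutive)
open import Data.Empty using (⊥-elim)
open import Data.Fin using (suc; _≟_)
import Data.Fin as Fin
open import Data.Fin.Properties using (pigeonhole; any?)
open import Data.List using ([]; _∷_; map; foldr)
open import Data.List.Membership.Propositional using (_∈_)
open import Data.List.Membership.Propositional.Properties
  using (∈-map⁺; ∈-concatMap⁺; ∈-filter⁺; ∈-filter⁻; ∈-++⁻; ∈-++⁺ˡ; ∈-++⁺ʳ)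
open import Data.List.Relation.Unary.Any using (here; there)
import Data.List.Relation.Unary.Any as Any
open import Data.Nat using (zero; _≤_; _<_; z≤n; s≤s; _≤?_)
open import Data.Nat.Induction using (<-wellFounded)
open import Data.Nat.Properties using (≤-refl; ≤-trans; m≤n⇒m≤1+n; n≤1+n; ≰⇒>; m≤n⇒m<n∨m≡n)
open import Data.Product using (Σ; _,_; proj₁; proj₂; curry′; uncurry′)
open import Data.Sum using (_⊎_; inj₁; inj₂; [_,_])
open import Induction.WellFounded using (Acc; acc)
open import Relation.Binary.PropositionalEquality
  using (_≡_; _≗_; refl; sym; trans; cong; cong₂; subst; module ≡-Reasoning)
open import Relation.Nullary using (yes; no; does)

∧-true⁻ : ∀ {a b} → a ∧ b ≡ true → a ≡ true × b ≡ true
∧-true⁻ {true} {true} refl = refl , refl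

∧-true⁺ : ∀ {a b} → a ≡ true → b ≡ true → a ∧ b ≡ true
∧-true⁺ refl refl = refl

not-true⁻ : ∀ {a} → not a ≡ true → a ≡ false
not-true⁻ {false} refl = refl

implies-true⁻ : ∀ {a b} → not (a ∧ not b) ≡ true → a ≡ true → b ≡ true
implies-true⁻ {true} {true} _ _ = refl

implies-true⁺ : ∀ {a b} → (a ≡ true → b ≡ true) → not (a ∧ not b) ≡ true
implies-true⁺ {true} {true} _ = refl
implies-true⁺ {true} {false} f = f refl
implies-true⁺ {false} _ = refl

or-true⁻ : ∀ {a b} → not (not a ∧ not b) ≡ true → a ≡ true ⊎ b ≡ true
or-true⁻ {true} _ = inj₁ refl
or-true⁻ {false} {true} _ = inj₂ refl

or-trueˡ : ∀ {a b} → a ≡ true → not (not a ∧ not b) ≡ true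
or-trueˡ refl = refl

or-trueʳ : ∀ {a b} → b ≡ true → not (not a ∧ not b) ≡ true
or-trueʳ {true} _ = refl
or-trueʳ {false} refl = refl

not-∧-not : ∀ a b → not (not a ∧ not b) ≡ a ∨ b
not-∧-not true _ = refl
not-∧-not false b = not-involutive b

true-⇔⇒≡ : ∀ {a b} → (a ≡ true → b ≡ true) → (b ≡ true → a ≡ true) → a ≡ b
true-⇔⇒≡ {true} to _ = sym (to refl)
true-⇔⇒≡ {false} {true} _ from = from refl
true-⇔⇒≡ {false} {false} _ _ = refl

allFin-complete : ∀ {m} (i : Fin m) → i ∈ allFin m
allFin-complete zero = here refl
allFin-complete (suc i) = there (∈-map⁺ suc (allFin-complete i))

allFuns-complete : ∀ m k (f : Fin m → Fin k) → Σ (Fin m → Fin k) λ g → g ∈ allFuns m k × g ≗ f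
allFuns-complete zero k f = _ , here refl , λ ()
allFuns-complete (suc m) k f with g , g∈ , g≗f ← allFuns-complete m k (λ w → f (suc w)) =
  consF (f zero) g ,
  ∈-concatMap⁺ (λ h → map (λ i → consF i h) (allFin k))
    (Any.map (λ { refl → ∈-map⁺ (λ i → consF i g) (allFin-complete (f zero)) }) g∈) ,
  λ { zero → refl ; (suc w) → g≗f w }

anyL-true⁻ : ∀ {A : Set} (p : A → Bool) xs → anyL p xs ≡ true → Σ A λ x → x ∈ xs × p x ≡ true
anyL-true⁻ p (x ∷ xs) h with p x in px
... | true = x , here refl , px
... | false with y , y∈ , py ← anyL-true⁻ p xs h = y , there y∈ , py

anyL-true⁺ : ∀ {A : Set} (p : A → Bool) {x} xs → x ∈ xs → p x ≡ true → anyL p xs ≡ true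
anyL-true⁺ p (y ∷ xs) (here refl) px rewrite px = refl
anyL-true⁺ p (y ∷ xs) (there x∈) px with p y
... | true = refl
... | false = anyL-true⁺ p xs x∈ px

anyL-cong : ∀ {A : Set} {p q : A → Bool} → p ≗ q → ∀ xs → anyL p xs ≡ anyL q xs
anyL-cong p≗q [] = refl
anyL-cong p≗q (x ∷ xs) = cong₂ _∨_ (p≗q x) (anyL-cong p≗q xs)

evalPL-cong : ∀ {A : Set} {ν ν' : A → Bool} χ → (∀ a → a ∈ sigPL χ → ν a ≡ ν' a) →
  evalPL ν χ ≡ evalPL ν' χ
evalPL-cong (atom a) agree = agree a (here refl)
evalPL-cong ⊤p agree = refl
evalPL-cong (¬p χ) agree = cong not (evalPL-cong χ agree)
evalPL-cong (χ ∧p χ') agree =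
  cong₂ _∧_ (evalPL-cong χ (λ a a∈ → agree a (∈-++⁺ˡ a∈)))
            (evalPL-cong χ' (λ a a∈ → agree a (∈-++⁺ʳ (sigPL χ) a∈)))

module _ {m : ℕ} (R : Rel m) where

  eval-cong : ∀ {A : Set} {V V' : A → Fin m → Bool} → (∀ a w → V a w ≡ V' a w) →
    ∀ δ w → eval R V δ w ≡ eval R V' δ w
  eval-cong V≗V' (var a) w = V≗V' a w
  eval-cong V≗V' ⊤m w = refl
  eval-cong V≗V' (¬m δ) w = cong not (eval-cong V≗V' δ w)
  eval-cong V≗V' (δ ∧m δ') w = cong₂ _∧_ (eval-cong V≗V' δ w) (eval-cong V≗V' δ' w)
  eval-cong V≗V' (◇ δ) w =
    anyL-cong (λ v → cong (R w v ∧_) (eval-cong V≗V' δ v)) (allFin m)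

  eval-substMF : ∀ {A C : Set} (V : C → Fin m → Bool) (s : A → MF C) δ w →
    eval R V (substMF s δ) w ≡ eval R (λ a → eval R V (s a)) δ w
  eval-substMF V s (var a) w = refl
  eval-substMF V s ⊤m w = refl
  eval-substMF V s (¬m δ) w = cong not (eval-substMF V s δ w)
  eval-substMF V s (δ ∧m δ') w = cong₂ _∧_ (eval-substMF V s δ w) (eval-substMF V s δ' w)
  eval-substMF V s (◇ δ) w =
    anyL-cong (λ v → cong (R w v ∧_) (eval-substMF V s δ v)) (allFin m)

  eval-embed : ∀ {A : Set} (V : A → Fin m → Bool) χ w →
    eval R V (embed χ) w ≡ evalPL (λ a → V a w) χ
  eval-embed V (atom a) w = refl
  eval-embed V ⊤p w = refl
  eval-embed V (¬p χ) w = cong not (eval-embed V χ w)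
  eval-embed V (χ ∧p χ') w = cong₂ _∧_ (eval-embed V χ w) (eval-embed V χ' w)

data Walk {m : ℕ} (R : Rel m) : ℕ → Fin m → Fin m → Set where
  ε   : ∀ {w} → Walk R 0 w w
  _◅_ : ∀ {k u v w} → R u v ≡ true → Walk R k v w → Walk R (suc k) u w

module Kripke {m : ℕ} (R : Rel m) {A : Set} (V : A → Fin m → Bool) where

  ◇-true⁻ : ∀ a w → eval R V (◇ a) w ≡ true → Σ (Fin m) λ v → R w v ≡ true × eval R V a v ≡ true
  ◇-true⁻ a w h with v , _ , Rwv∧a ← anyL-true⁻ _ (allFin m) h = v , ∧-true⁻ Rwv∧a

  ◇-true⁺ : ∀ a {w v} → R w v ≡ true → eval R V a v ≡ true → eval R V (◇ a) w ≡ true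
  ◇-true⁺ a {w} {v} Rwv av =
    anyL-true⁺ (λ v → R w v ∧ eval R V a v) (allFin m) (allFin-complete v) (∧-true⁺ Rwv av)

  □-true⁻ : ∀ a {w v} → eval R V (□ a) w ≡ true → R w v ≡ true → eval R V a v ≡ true
  □-true⁻ a {v = v} □a Rwv with eval R V a v in av
  ... | true = refl
  ... | false = ⊥-elim (not-¬ (◇-true⁺ (¬m a) Rwv (cong not av)) (not-true⁻ □a))

  □-true⁺ : ∀ a w → (∀ v → R w v ≡ true → eval R V a v ≡ true) → eval R V (□ a) w ≡ true
  □-true⁺ a w all with eval R V (◇ (¬m a)) w in ◇¬a
  ... | false = refl
  ... | true with v , Rwv , ¬av ← ◇-true⁻ (¬m a) w ◇¬a = ⊥-elim (not-¬ (all v Rwv) (not-true⁻ ¬av))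

  □^-walk : ∀ a k {u v} → eval R V (□^ k a) u ≡ true → Walk R k u v → eval R V a v ≡ true
  □^-walk a zero □a ε = □a
  □^-walk a (suc k) □a (Ruv ◅ p) = □^-walk a k (□-true⁻ (□^ k a) □a Ruv) p

  □≤-walk : ∀ a N {k u v} → eval R V (□≤ N a) u ≡ true → k ≤ N → Walk R k u v → eval R V a v ≡ true
  □≤-walk a zero □a z≤n p = □^-walk a zero □a p
  □≤-walk a (suc N) □a k≤N p with m≤n⇒m<n∨m≡n k≤N
  ... | inj₁ (s≤s k≤N') = □≤-walk a N (proj₁ (∧-true⁻ □a)) k≤N' p
  ... | inj₂ refl = □^-walk a (suc N) (proj₂ (∧-true⁻ □a)) p

  □^-everywhere : ∀ a → (∀ v → eval R V a v ≡ true) → ∀ k u → eval R V (□^ k a) u ≡ true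
  □^-everywhere a all zero u = all u
  □^-everywhere a all (suc k) u = □-true⁺ (□^ k a) u (λ v _ → □^-everywhere a all k v)

  □≤-everywhere : ∀ a → (∀ v → eval R V a v ≡ true) → ∀ N u → eval R V (□≤ N a) u ≡ true
  □≤-everywhere a all zero u = all u
  □≤-everywhere a all (suc N) u = ∧-true⁺ (□≤-everywhere a all N u) (□^-everywhere a all (suc N) u)

  ◇≤-witness : ∀ a N u → eval R V (◇≤ N a) u ≡ true → Σ (Fin m) λ v → eval R V a v ≡ true
  ◇≤-witness a N u ◇a with any? (λ v → eval R V a v Bool.≟ true)
  ... | yes found = found
  ... | no none = ⊥-elim (not-¬ (□≤-everywhere (¬m a) ¬a N u) (not-true⁻ ◇a))
    where
    ¬a : ∀ v → eval R V (¬m a) v ≡ true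
    ¬a v = cong not (¬-not (λ av → none (v , av)))

  ⋀m-true⁺ : ∀ {ℓ} {C : Set ℓ} (g : C → MF A) xs w → (∀ x → x ∈ xs → eval R V (g x) w ≡ true) →
    eval R V (⋀m (map g xs)) w ≡ true
  ⋀m-true⁺ g [] w all = refl
  ⋀m-true⁺ g (x ∷ xs) w all = ∧-true⁺ (all x (here refl)) (⋀m-true⁺ g xs w (λ y y∈ → all y (there y∈)))

  ⋀m-true⁻ : ∀ {ℓ} {C : Set ℓ} (g : C → MF A) xs w → eval R V (⋀m (map g xs)) w ≡ true →
    ∀ {x} → x ∈ xs → eval R V (g x) w ≡ true
  ⋀m-true⁻ g (x ∷ xs) w h (here refl) = proj₁ (∧-true⁻ h)
  ⋀m-true⁻ g (x ∷ xs) w h (there x∈) = ⋀m-true⁻ g xs w (proj₂ (∧-true⁻ h)) x∈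

  ⋁m-true⁺ : ∀ {ℓ} {C : Set ℓ} (g : C → MF A) xs w {x} → x ∈ xs → eval R V (g x) w ≡ true →
    eval R V (⋁m (map g xs)) w ≡ true
  ⋁m-true⁺ g (x ∷ xs) w (here refl) gx = or-trueˡ gx
  ⋁m-true⁺ g (x ∷ xs) w (there x∈) gx = or-trueʳ {eval R V (g x) w} (⋁m-true⁺ g xs w x∈ gx)

  ⋁m-true⁻ : ∀ {ℓ} {C : Set ℓ} (g : C → MF A) xs w → eval R V (⋁m (map g xs)) w ≡ true →
    Σ C λ x → x ∈ xs × eval R V (g x) w ≡ true
  ⋁m-true⁻ g (x ∷ xs) w h with or-true⁻ {eval R V (g x) w} h
  ... | inj₁ gx = x , here refl , gx
  ... | inj₂ rest with y , y∈ , gy ← ⋁m-true⁻ g xs w rest = y , there y∈ , gy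

-- Walks in a finite frame

module _ {m : ℕ} {R : Rel m} where

  vertex : ∀ {k u w} → Walk R k u w → Fin (suc k) → Fin m
  vertex {u = u} p zero = u
  vertex (_ ◅ p) (suc i) = vertex p i

  suffix : ∀ {k u w} (p : Walk R k u w) i → Σ ℕ λ k' → k' ≤ k × Walk R k' (vertex p i) w
  suffix p zero = _ , ≤-refl , p
  suffix (_ ◅ p) (suc i) with k' , k'≤k , q ← suffix p i = k' , m≤n⇒m≤1+n k'≤k , q

  remove-loop : ∀ {k u w} (p : Walk R k u w) (i j : Fin (suc k)) → i Fin.< j → vertex p i ≡ vertex p j →
    Σ ℕ λ k' → k' < k × Walk R k' u w
  remove-loop (_ ◅ p) zero (suc j) _ u≡vⱼ with k' , k'≤k , q ← suffix p j =
    k' , s≤s k'≤k , subst (λ x → Walk R k' x _) (sym u≡vⱼ) q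
  remove-loop (Ruv ◅ p) (suc i) (suc j) (s≤s i<j) vᵢ≡vⱼ with k' , k'<k , q ← remove-loop p i j i<j vᵢ≡vⱼ =
    suc k' , s≤s k'<k , Ruv ◅ q

  reach⇒walk : ∀ {u w} → Reach R u w → Σ ℕ λ k → Walk R k u w
  reach⇒walk here = zero , ε
  reach⇒walk (step Ruv v⇝w) with k , p ← reach⇒walk v⇝w = suc k , Ruv ◅ p

module _ {n : ℕ} {R : Rel (suc n)} where

  walk-shorten : ∀ {k u w} → Walk R k u w → Σ ℕ λ k' → k' ≤ n × Walk R k' u w
  walk-shorten p = go (<-wellFounded _) p
    where
    go : ∀ {k u w} → Acc _<_ k → Walk R k u w → Σ ℕ λ k' → k' ≤ n × Walk R k' u w
    go {k} (acc shorter) p with k ≤? n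
    ... | yes k≤n = k , k≤n , p
    ... | no k≰n =
      let i , j , i<j , vᵢ≡vⱼ = pigeonhole (s≤s (≰⇒> k≰n)) (vertex p)
          k' , k'<k , q = remove-loop p i j i<j vᵢ≡vⱼ
      in go (shorter k'<k) q

  rooted-walk : Rooted R → ∀ w → Σ ℕ λ k → k ≤ n × Walk R k zero w
  rooted-walk rooted w = walk-shorten (proj₂ (reach⇒walk (rooted w)))

  module RootedKripke (rooted : Rooted R) {A : Set} (V : A → Fin (suc n) → Bool) where
    open Kripke R V

    □≤-root⁻ : ∀ a {N} → n ≤ N → eval R V (□≤ N a) zero ≡ true → ∀ v → eval R V a v ≡ true
    □≤-root⁻ a {N} n≤N □a v with k , k≤n , p ← rooted-walk rooted v =
      □≤-walk a N □a (≤-trans k≤n n≤N) p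

    ◇≤-root⁺ : ∀ a {N v} → n ≤ N → eval R V a v ≡ true → eval R V (◇≤ N a) zero ≡ true
    ◇≤-root⁺ a {N} {v} n≤N av with eval R V (□≤ N (¬m a)) zero in □¬a
    ... | false = refl
    ... | true = ⊥-elim (not-¬ av (not-true⁻ (□≤-root⁻ (¬m a) n≤N □¬a v)))

-- The translation tr

module _ {m : ℕ} (R : Rel m) where

  eval-tr : ∀ ν w χ → evalPL ν (tr R w χ) ≡ eval R (curry′ ν) χ w
  eval-tr-◇ : ∀ ν w χ xs →
    evalPL ν (foldr (λ w' acc → if R w w' then (tr R w' χ ∨p acc) else acc) ⊥p xs)
      ≡ anyL (λ w' → R w w' ∧ eval R (curry′ ν) χ w') xs
  eval-tr ν w (var p) = refl
  eval-tr ν w ⊤m = refl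
  eval-tr ν w (¬m χ) = cong not (eval-tr ν w χ)
  eval-tr ν w (χ ∧m χ') = cong₂ _∧_ (eval-tr ν w χ) (eval-tr ν w χ')
  eval-tr ν w (◇ χ) = eval-tr-◇ ν w χ (allFin m)
  eval-tr-◇ ν w χ [] = refl
  eval-tr-◇ ν w χ (v ∷ vs) with R w v
  ... | true = trans (cong₂ (λ a b → not (not a ∧ not b)) (eval-tr ν v χ) (eval-tr-◇ ν w χ vs))
                     (not-∧-not (eval R (curry′ ν) χ v) _)
  ... | false = eval-tr-◇ ν w χ vs

  sig-tr : ∀ w χ {a} → a ∈ sigPL (tr R w χ) → proj₁ a ∈ sig χ
  sig-tr-◇ : ∀ w χ xs {a} →
    a ∈ sigPL (foldr (λ w' acc → if R w w' then (tr R w' χ ∨p acc) else acc) ⊥p xs) → proj₁ a ∈ sig χ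
  sig-tr w (var p) (here refl) = here refl
  sig-tr w (¬m χ) a∈ = sig-tr w χ a∈
  sig-tr w (χ ∧m χ') a∈ with ∈-++⁻ (sigPL (tr R w χ)) a∈
  ... | inj₁ a∈ˡ = ∈-++⁺ˡ (sig-tr w χ a∈ˡ)
  ... | inj₂ a∈ʳ = ∈-++⁺ʳ (sig χ) (sig-tr w χ' a∈ʳ)
  sig-tr w (◇ χ) a∈ = sig-tr-◇ w χ (allFin m) a∈
  sig-tr-◇ w χ (v ∷ vs) a∈ with R w v
  ... | false = sig-tr-◇ w χ vs a∈
  ... | true with ∈-++⁻ (sigPL (tr R v χ)) a∈
  ...   | inj₁ a∈ˡ = sig-tr v χ a∈ˡ
  ...   | inj₂ a∈ʳ = sig-tr-◇ w χ vs a∈ʳ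

InLog⇒Taut-tr : ∀ {n} (R : Rel (suc n)) χ → InLog R χ → Taut (tr R zero χ)
InLog⇒Taut-tr R χ valid ν = trans (eval-tr R ν zero χ) (valid (curry′ ν))

module _ {m : ℕ} (R : Rel m) {A : Set} {σ : List A} {V V' : A → Fin m → Bool}
  {Z : Fin m → Fin m → Set}
  (forth : ∀ w w' v → Z w w' → R w v ≡ true → Σ (Fin m) λ v' → R w' v' ≡ true × Z v v')
  (back : ∀ w w' v' → Z w w' → R w' v' ≡ true → Σ (Fin m) λ v → R w v ≡ true × Z v v')
  (atoms : ∀ {p w w'} → p ∈ σ → Z w w' → V p w ≡ V' p w') where

  bisim-invariant : ∀ χ → sig χ ⊆ σ → ∀ {w w'} → Z w w' → eval R V χ w ≡ eval R V' χ w'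
  bisim-invariant (var p) χ⊆σ z = atoms (χ⊆σ (here refl)) z
  bisim-invariant ⊤m χ⊆σ z = refl
  bisim-invariant (¬m χ) χ⊆σ z = cong not (bisim-invariant χ χ⊆σ z)
  bisim-invariant (χ ∧m χ') χ⊆σ z =
    cong₂ _∧_ (bisim-invariant χ (λ a∈ → χ⊆σ (∈-++⁺ˡ a∈)) z)
              (bisim-invariant χ' (λ a∈ → χ⊆σ (∈-++⁺ʳ (sig χ) a∈)) z)
  bisim-invariant (◇ χ) χ⊆σ {w} {w'} z = true-⇔⇒≡
    (λ ◇χ → let v , Rwv , χv = Kripke.◇-true⁻ R V χ w ◇χ
                v' , Rw'v' , z' = forth w w' v z Rwv
            in Kripke.◇-true⁺ R V' χ Rw'v' (trans (sym (bisim-invariant χ χ⊆σ z')) χv))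
    (λ ◇χ → let v' , Rw'v' , χv' = Kripke.◇-true⁻ R V' χ w' ◇χ
                v , Rwv , z' = back w w' v' z Rw'v'
            in Kripke.◇-true⁺ R V χ Rwv (trans (bisim-invariant χ χ⊆σ z') χv'))

sig-embed : ∀ {A : Set} (χ : PL A) {a} → a ∈ sig (embed χ) → a ∈ sigPL χ
sig-embed (atom a) a∈ = a∈
sig-embed (¬p χ) a∈ = sig-embed χ a∈
sig-embed (χ ∧p χ') a∈ with ∈-++⁻ (sig (embed χ)) a∈
... | inj₁ a∈ˡ = ∈-++⁺ˡ (sig-embed χ a∈ˡ)
... | inj₂ a∈ʳ = ∈-++⁺ʳ (sigPL χ) (sig-embed χ' a∈ʳ)

module _ {A : Set} {σ : List A} where

  ⊆-∧m : ∀ a b → sig a ⊆ σ → sig b ⊆ σ → sig (a ∧m b) ⊆ σ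
  ⊆-∧m a b a⊆σ b⊆σ x∈ = [ a⊆σ , b⊆σ ] (∈-++⁻ (sig a) x∈)

  ⊆-□^ : ∀ k a → sig a ⊆ σ → sig (□^ k a) ⊆ σ
  ⊆-□^ zero a a⊆σ = a⊆σ
  ⊆-□^ (suc k) a a⊆σ = ⊆-□^ k a a⊆σ

  ⊆-□≤ : ∀ N a → sig a ⊆ σ → sig (□≤ N a) ⊆ σ
  ⊆-□≤ zero a a⊆σ = a⊆σ
  ⊆-□≤ (suc N) a a⊆σ = ⊆-∧m (□≤ N a) (□^ (suc N) a) (⊆-□≤ N a a⊆σ) (⊆-□^ (suc N) a a⊆σ)

  ⊆-⋀m : ∀ {ℓ} {C : Set ℓ} (g : C → MF A) xs → (∀ x → x ∈ xs → sig (g x) ⊆ σ) →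
    sig (⋀m (map g xs)) ⊆ σ
  ⊆-⋀m g [] _ ()
  ⊆-⋀m g (x ∷ xs) all⊆σ =
    ⊆-∧m (g x) (⋀m (map g xs)) (all⊆σ x (here refl)) (⊆-⋀m g xs (λ y y∈ → all⊆σ y (there y∈)))

  ⊆-⋁m : ∀ {ℓ} {C : Set ℓ} (g : C → MF A) xs → (∀ x → x ∈ xs → sig (g x) ⊆ σ) →
    sig (⋁m (map g xs)) ⊆ σ
  ⊆-⋁m g [] _ ()
  ⊆-⋁m g (x ∷ xs) all⊆σ =
    ⊆-∧m (¬m g x) (¬m ⋁m (map g xs))
      (all⊆σ x (here refl)) (⊆-⋁m g xs (λ y y∈ → all⊆σ y (there y∈)))

  ⊆-substMF : ∀ {B : Set} (s : B → MF A) δ → (∀ b → b ∈ sig δ → sig (s b) ⊆ σ) →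
    sig (substMF s δ) ⊆ σ
  ⊆-substMF s (var b) s⊆σ = s⊆σ b (here refl)
  ⊆-substMF s (¬m δ) s⊆σ = ⊆-substMF s δ s⊆σ
  ⊆-substMF s (δ ∧m δ') s⊆σ =
    ⊆-∧m (substMF s δ) (substMF s δ') (⊆-substMF s δ (λ b b∈ → s⊆σ b (∈-++⁺ˡ b∈)))
                                      (⊆-substMF s δ' (λ b b∈ → s⊆σ b (∈-++⁺ʳ (sig δ) b∈)))
  ⊆-substMF s (◇ δ) s⊆σ = ⊆-substMF s δ s⊆σ

-- The abstract model induced by an EME

∨p-witness : ∀ {A I : Set} (Φ : I → PL A) ν is →
  evalPL ν (foldr (λ i acc → Φ i ∨p acc) ⊥p is) ≡ true → Σ I λ i → evalPL ν (Φ i) ≡ true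
∨p-witness Φ ν (i ∷ is) h with or-true⁻ {evalPL ν (Φ i)} h
... | inj₁ Φi = i , Φi
... | inj₂ rest = ∨p-witness Φ ν is rest

evalAbs-cong : ∀ {n k} (R : Rel (suc n)) {f g : Fin (suc n) → Fin k} → f ≗ g →
  ∀ δ w → evalAbs R f δ w ≡ evalAbs R g δ w
evalAbs-cong R f≗g = eval-cong R (λ i w → cong (λ j → does (j ≟ i)) (f≗g w))

classOf-complete : ∀ {n k} (R : Rel (suc n)) δ (f : Fin (suc n) → Fin k) → evalAbs R f δ zero ≡ true →
  Σ (Fin (suc n) → Fin k) λ g → g ∈ classOf R δ × g ≗ f
classOf-complete R δ f fδ with g , g∈ , g≗f ← allFuns-complete _ _ f =
  g , ∈-filter⁺ (λ f → evalAbs R f δ zero Bool.≟ true) g∈ (trans (evalAbs-cong R g≗f δ zero) fδ) , g≗f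

classOf-sound : ∀ {n k} (R : Rel (suc n)) δ {g : Fin (suc n) → Fin k} → g ∈ classOf R δ →
  evalAbs R g δ zero ≡ true
classOf-sound {n} {k} R δ g∈ =
  proj₂ (∈-filter⁻ (λ f → evalAbs R f δ zero Bool.≟ true) {xs = allFuns (suc n) k} g∈)

module Induced {n : ℕ} (R : Rel (suc n)) {σ : List ℕ} {k : ℕ} {Φ : Fin k → PL ℕ}
  (eme : IsEME σ k Φ) (V : ℕ → Fin (suc n) → Bool) where
  open Kripke R V

  holds : Fin k → Fin (suc n) → Bool
  holds i w = evalPL (λ p → V p w) (Φ i)

  embed-holds : ∀ i w → eval R V (embed (Φ i)) w ≡ holds i w
  embed-holds i = eval-embed R V (Φ i)

  member-exists : ∀ w → Σ (Fin k) λ i → holds i w ≡ true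
  member-exists w = ∨p-witness Φ (λ p → V p w) (allFin k) (IsEME.exhaust eme (λ p → V p w))

  member : Fin (suc n) → Fin k
  member w = proj₁ (member-exists w)

  member-holds : ∀ w → holds (member w) w ≡ true
  member-holds w = proj₂ (member-exists w)

  holds≡member : ∀ i w → holds i w ≡ does (member w ≟ i)
  holds≡member i w with member w ≟ i
  ... | yes refl = member-holds w
  ... | no member≢i = ¬-not λ Φi → not-¬ (∧-true⁺ (member-holds w) Φi)
                                         (not-true⁻ (IsEME.pairwise eme _ i member≢i (λ p → V p w)))

  concrete-eval : ∀ δ w → eval R V (concrete Φ δ) w ≡ evalAbs R member δ w
  concrete-eval δ w =
    trans (eval-substMF R V (λ i → embed (Φ i)) δ w)
          (eval-cong R (λ i v → trans (embed-holds i v) (holds≡member i v)) δ w)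

  cover-clause : Fin k → ℕ → Fm
  cover-clause i p = ◇≤ (suc n) (embed (Φ i) ∧m var p) →m □≤ (suc n) (embed (Φ i) →m var p)

  cover-witness : IsCover σ Φ V → ∀ {i p w} N → p ∈ σ →
    eval R V (◇≤ N (embed (Φ i) ∧m var p)) zero ≡ true → holds i w ≡ true → V p w ≡ true
  cover-witness cover {i} {p} {w} N p∈ ◇Φp Φw =
    let u , Φp-u = ◇≤-witness (embed (Φ i) ∧m var p) N zero ◇Φp
        Φu , pu = ∧-true⁻ Φp-u
    in trans (sym (cover i u w (trans (sym (embed-holds i u)) Φu) Φw p p∈)) pu

  IsCover⇒coverF : IsCover σ Φ V → eval R V (coverF (suc n) σ Φ) zero ≡ true
  IsCover⇒coverF cover =
    ⋀m-true⁺ (λ i → ⋀m (map (cover-clause i) σ)) (allFin k) zero λ i _ →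
    ⋀m-true⁺ (cover-clause i) σ zero λ p p∈ → implies-true⁺ λ ◇Φp →
    □≤-everywhere (embed (Φ i) →m var p)
      (λ v → implies-true⁺ λ Φv → cover-witness cover (suc n) p∈ ◇Φp (trans (sym (embed-holds i v)) Φv))
      (suc n) zero

  -- the propositional valuation under which ξ is evaluated in ξ^g
  inst-val : (Fin (suc n) → Fin k) → ℕ × Fin (suc n) → Bool
  inst-val g (p , w) = eval R V (◇≤ (suc n) (embed (Φ (g w)) ∧m var p)) zero

  eval-instF : ∀ g ξ → eval R V (instF Φ g ξ) zero ≡ evalPL (inst-val g) ξ
  eval-instF g ξ = trans (eval-substMF R V _ (embed ξ) zero) (eval-embed R _ ξ zero)

  module _ (rooted : Rooted R) where
    open RootedKripke rooted V

    coverF⇒IsCover : eval R V (coverF (suc n) σ Φ) zero ≡ true → IsCover σ Φ V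
    coverF⇒IsCover cover i w w' Φw Φw' p p∈ = true-⇔⇒≡ (transfer Φw Φw') (transfer Φw' Φw)
      where
      clause : eval R V (cover-clause i p) zero ≡ true
      clause = ⋀m-true⁻ (cover-clause i) σ zero
                 (⋀m-true⁻ (λ i → ⋀m (map (cover-clause i) σ)) (allFin k) zero cover (allFin-complete i)) p∈
      transfer : ∀ {u v} → holds i u ≡ true → holds i v ≡ true → V p u ≡ true → V p v ≡ true
      transfer {u} {v} Φu Φv pu =
        let ◇Φp = ◇≤-root⁺ (embed (Φ i) ∧m var p) (n≤1+n n) (∧-true⁺ (trans (embed-holds i u) Φu) pu)
        in implies-true⁻ (□≤-root⁻ _ (n≤1+n n) (implies-true⁻ clause ◇Φp) v) (trans (embed-holds i v) Φv)

    inst-val-cover : IsCover σ Φ V → ∀ g {p} w w' → p ∈ σ → member w ≡ g w' → inst-val g (p , w') ≡ V p w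
    inst-val-cover cover g {p} w w' p∈ member≡g = true-⇔⇒≡
      (λ ◇Φp → cover-witness cover (suc n) p∈ ◇Φp Φw)
      (λ pw → ◇≤-root⁺ (embed (Φ (g w')) ∧m var p) (n≤1+n n) (∧-true⁺ (trans (embed-holds _ w) Φw) pw))
      where
      Φw : holds (g w') w ≡ true
      Φw = subst (λ i → holds i w ≡ true) member≡g (member-holds w)

-- The formula rt(ξ)

AgreeOn : ∀ {n} → Rel (suc n) → List ℕ → (V V' : ℕ → Fin (suc n) → Bool) → Set
AgreeOn R σ V V' = ∀ ψ → sig ψ ⊆ σ → eval R V ψ zero ≡ eval R V' ψ zero

module _ {n : ℕ} (R : Rel (suc n)) {σ : List ℕ} (ξ : PL (ℕ × Fin (suc n))) where

  clause : (e : EncEntry R σ) → MF (Fin (EncEntry.k e)) → Fm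
  clause e δ = (coverF (suc n) σ Φ ∧m concrete Φ δ) →m ⋁m (map (λ f → instF Φ f ξ) (classOf R δ))
    where open EncEntry e

  clause-sig : (∀ {a} → a ∈ sigPL ξ → InSigF σ a) → ∀ e δ → sig (clause e δ) ⊆ σ
  clause-sig ξ⊆σF e δ =
    ⊆-∧m (coverF (suc n) σ Φ ∧m concrete Φ δ) (¬m ⋁m (map (λ f → instF Φ f ξ) (classOf R δ)))
      (⊆-∧m (coverF (suc n) σ Φ) (concrete Φ δ) cover-sig (⊆-substMF _ δ λ i _ → Φ⊆σ i))
      (⊆-⋁m (λ f → instF Φ f ξ) (classOf R δ) λ f _ → inst-sig f)
    where
    open EncEntry e
    Φ⊆σ : ∀ i → sig (embed (Φ i)) ⊆ σ
    Φ⊆σ i a∈ = IsEME.overσ eme i (sig-embed (Φ i) a∈)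
    Φp⊆σ : ∀ i {p} → p ∈ σ → sig (embed (Φ i) ∧m var p) ⊆ σ
    Φp⊆σ i p∈ = ⊆-∧m (embed (Φ i)) (var _) (Φ⊆σ i) λ { (here refl) → p∈ }
    cover-sig : sig (coverF (suc n) σ Φ) ⊆ σ
    cover-sig = ⊆-⋀m _ (allFin k) λ i _ → ⊆-⋀m _ σ λ p p∈ →
      ⊆-∧m (◇≤ (suc n) (embed (Φ i) ∧m var p)) (□≤ (suc n) (embed (Φ i) →m var p))
        (⊆-□≤ (suc n) _ (Φp⊆σ i p∈)) (⊆-□≤ (suc n) _ (Φp⊆σ i p∈))
    inst-sig : ∀ f → sig (instF Φ f ξ) ⊆ σ
    inst-sig f = ⊆-substMF _ (embed ξ) λ a a∈ → ⊆-□≤ (suc n) _ (Φp⊆σ _ (ξ⊆σF (sig-embed ξ a∈)))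

  rt-sig : (∀ {a} → a ∈ sigPL ξ → InSigF σ a) → ∀ E → sig (rt R σ E ξ) ⊆ σ
  rt-sig ξ⊆σF E =
    ⊆-⋀m _ (Encoding.Γ E) λ e _ → ⊆-⋀m (clause e) (EncEntry.Δ e) λ δ _ → clause-sig ξ⊆σF e δ

  module _ (rooted : Rooted R) (V : ℕ → Fin (suc n) → Bool) where
    open Kripke R V

    clause-holds : (∀ {a} → a ∈ sigPL ξ → InSigF σ a) → evalPL (uncurry′ V) ξ ≡ true →
      ∀ e δ → eval R V (clause e δ) zero ≡ true
    clause-holds ξ⊆σF ξ-true e δ = implies-true⁺ λ premise →
      let cover , δ-true = ∧-true⁻ premise
          g , g∈ , g≗member = classOf-complete R δ member (trans (sym (concrete-eval δ zero)) δ-true)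
      in ⋁m-true⁺ (λ f → instF Φ f ξ) (classOf R δ) zero g∈ (begin
           eval R V (instF Φ g ξ) zero  ≡⟨ eval-instF g ξ ⟩
           evalPL (inst-val g) ξ        ≡⟨ evalPL-cong ξ (reads-V cover g≗member) ⟩
           evalPL (uncurry′ V) ξ        ≡⟨ ξ-true ⟩
           true                         ∎)
      where
      open EncEntry e
      open Induced R eme V
      open ≡-Reasoning
      reads-V : eval R V (coverF (suc n) σ Φ) zero ≡ true → ∀ {g} → g ≗ member →
        ∀ a → a ∈ sigPL ξ → inst-val g a ≡ uncurry′ V a
      reads-V cover {g} g≗member (p , w) a∈ =
        inst-val-cover rooted (coverF⇒IsCover rooted cover) g w w (ξ⊆σF a∈) (sym (g≗member w))

    clause-realised : ∀ e → IsCover σ (EncEntry.Φ e) V → ∀ {δ} → δ ∈ EncEntry.Δ e →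
      eval R V (concrete (EncEntry.Φ e) δ) zero ≡ true → eval R V (clause e δ) zero ≡ true →
      Σ (ℕ × Fin (suc n) → Bool) λ ν → evalPL ν ξ ≡ true × AgreeOn R σ V (curry′ ν)
    clause-realised e cover {δ} δ∈ δ-true clause-true =
      let g , g∈ , inst-true = ⋁m-true⁻ (λ f → instF Φ f ξ) (classOf R δ) zero
                                 (implies-true⁻ clause-true (∧-true⁺ (IsCover⇒coverF cover) δ-true))
          Z , Z00 , Z-member , forth , back = IsACI.allBisim (aci δ∈) member g
                                                (trans (sym (concrete-eval δ zero)) δ-true) (classOf-sound R δ g∈)
          reads-V : ∀ {p w w'} → p ∈ σ → Z w w' → V p w ≡ curry′ (inst-val g) p w'
          reads-V {w = w} {w'} p∈ z = sym (inst-val-cover rooted cover g w w' p∈ (Z-member w w' z))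
      in inst-val g ,
         trans (sym (eval-instF g ξ)) inst-true ,
         λ ψ ψ⊆σ → bisim-invariant R forth back reads-V ψ ψ⊆σ Z00
      where
      open EncEntry e
      open Induced R eme V

    rt-holds : (∀ {a} → a ∈ sigPL ξ → InSigF σ a) → evalPL (uncurry′ V) ξ ≡ true →
      ∀ E → eval R V (rt R σ E ξ) zero ≡ true
    rt-holds ξ⊆σF ξ-true E =
      ⋀m-true⁺ _ (Encoding.Γ E) zero λ e _ →
      ⋀m-true⁺ (clause e) (EncEntry.Δ e) zero λ δ _ → clause-holds ξ⊆σF ξ-true e δ

    rt-realised : ∀ E → eval R V (rt R σ E ξ) zero ≡ true →
      Σ (ℕ × Fin (suc n) → Bool) λ ν → evalPL ν ξ ≡ true × AgreeOn R σ V (curry′ ν)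
    rt-realised E rt-true with e , e∈ , cover , δ , δ∈ , δ-true ← Encoding.total E V =
      clause-realised e cover δ∈ δ-true
        (⋀m-true⁻ (clause e) (EncEntry.Δ e) zero (⋀m-true⁻ _ (Encoding.Γ E) zero rt-true e∈) δ∈)

theorem4p8 : (n : ℕ) (R : Rel (suc n)) → Rooted R →
    (φ : Fm) (σ : List ℕ) → σ ⊆ sig φ →
    (E : Encoding R σ) →
    (ξ : PL (ℕ × Fin (suc n))) →
    IsUniformInterpolant (InSigF σ) (tr R zero φ) ξ →
    IsStrongestImplicate R σ φ (rt R σ E ξ)
theorem4p8 n R rooted φ σ _ E ξ (ξ⊆σF , tr-φ⇒ξ , ξ-uniform) = rt-sig R ξ ξ⊆σF E , implied , strongest
  where
  implied : InLog R (φ →m rt R σ E ξ)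
  implied V = implies-true⁺ λ φ-true →
    let ξ-true = implies-true⁻ (tr-φ⇒ξ (uncurry′ V)) (trans (eval-tr R (uncurry′ V) zero φ) φ-true)
    in rt-holds R ξ rooted V ξ⊆σF ξ-true E

  strongest : (ψ : Fm) → sig ψ ⊆ σ → InLog R (φ →m ψ) → InLog R (rt R σ E ξ →m ψ)
  strongest ψ ψ⊆σ φ⇒ψ V = implies-true⁺ λ rt-true →
    let ν , ξ-true , agree = rt-realised R ξ rooted V E rt-true
        ξ⇒tr-ψ = ξ-uniform (tr R zero ψ) (λ a a∈ _ → ψ⊆σ (sig-tr R zero ψ a∈)) (InLog⇒Taut-tr R (φ →m ψ) φ⇒ψ)
    in trans (agree ψ ψ⊆σ) (trans (sym (eval-tr R ν zero ψ)) (implies-true⁻ (ξ⇒tr-ψ ν) ξ-true))
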